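{- Let $d\ge 2$ and $n,k\ge 0$ be integers. Then $N_d(n,k)$ equals the number of labelled Schröder paths in $\widetilde{\mathcal{S}}_d$ with semilength $n$ and with exactly $k$ occurrences in total of $H$ and $DD$.
   Context: $N_d(n,k) = \frac{1}{n+1} \binom{n+1}{k+1} \binom{ n + (n-k)(d-2)+1}{k}$. A Schröder path is a lattice path from $(0,0)$ using up steps $U=(1,1)$, down steps $D=(1,-1)$ and horizontal steps $H=(2,0)$, never going below the $x$-axis and ending on the $x$-axis at $(2m,0)$; $m$ is its semilength (the empty path, with $m=0$, is allowed). A descent is a maximal run of consecutive down steps. $\widetilde{\mathcal{S}}_d$ is the set of pairs consisting of a Schröder path in which every descent has length at most $d-1$, together with a labelling assigning to each descent of length $\ell\ge 1$ an $(\ell-1)$-element subset of $[d-2]=\{1,\dots,d-2\}$. The number of occurrences of $H$ and $DD$ is the number of $H$ steps plus the number of positions where a $D$ step is immediately followed by a $D$ step (so a descent of length $\ell$ contributes $\ell-1$). -}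

module Defs where

open import Data.Nat using (ℕ; zero; suc; _+_; _*_; _∸_; _≤_)
open import Data.Bool using (Bool; true; false; T)
open import Data.List using (List; []; _∷_)
open import Data.List.Relation.Unary.All using (All)
open import Data.List.Relation.Binary.Pointwise using (Pointwise)
open import Data.Fin.Subset using (Subset; ∣_∣)
open import Data.Nat.Combinatorics using (_C_)
open import Relation.Binary.PropositionalEquality using (_≡_)

-- Steps: U = (1,1), D = (1,-1), H = (2,0)
data Step : Set where
  U D H : Step

width : List Step → ℕ
width []      = 0
width (U ∷ s) = suc (width s)
width (D ∷ s) = suc (width s)
width (H ∷ s) = suc (suc (width s))

staysAbove : ℕ → List Step → Bool
staysAbove zero    []      = true
staysAbove (suc _) []      = false
staysAbove h       (U ∷ s) = staysAbove (suc h) s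
staysAbove zero    (D ∷ s) = false
staysAbove (suc h) (D ∷ s) = staysAbove h s
staysAbove h       (H ∷ s) = staysAbove h s

IsSchroeder : List Step → Set
IsSchroeder p = T (staysAbove 0 p)

-- lengths of the maximal runs of D steps (descents), left to right;
-- the first argument is the length of the current (unfinished) run
descentsFrom : ℕ → List Step → List ℕ
descentsFrom zero    []      = []
descentsFrom (suc c) []      = suc c ∷ []
descentsFrom c       (D ∷ s) = descentsFrom (suc c) s
descentsFrom zero    (U ∷ s) = descentsFrom 0 s
descentsFrom (suc c) (U ∷ s) = suc c ∷ descentsFrom 0 s
descentsFrom zero    (H ∷ s) = descentsFrom 0 s
descentsFrom (suc c) (H ∷ s) = suc c ∷ descentsFrom 0 s

descents : List Step → List ℕ
descents = descentsFrom 0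

hCount : List Step → ℕ
hCount []      = 0
hCount (H ∷ s) = suc (hCount s)
hCount (U ∷ s) = hCount s
hCount (D ∷ s) = hCount s

ddCount : List Step → ℕ
ddCount []            = 0
ddCount (D ∷ D ∷ s)   = suc (ddCount (D ∷ s))
ddCount (D ∷ U ∷ s)   = ddCount (U ∷ s)
ddCount (D ∷ H ∷ s)   = ddCount (H ∷ s)
ddCount (D ∷ [])      = 0
ddCount (U ∷ s)       = ddCount s
ddCount (H ∷ s)       = ddCount s

-- Labels: one subset of [d-2] (modelled as Subset (d ∸ 2), i.e. subsets of
-- Fin (d ∸ 2)) per descent, in left-to-right order, of size (length - 1).
record LabelledSchroeder (d n k : ℕ) : Set where
  field
    path       : List Step
    schroeder  : IsSchroeder path
    semilength : width path ≡ 2 * n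
    descBound  : All (λ ℓ → ℓ ≤ d ∸ 1) (descents path)
    labels     : List (Subset (d ∸ 2))
    labelsOK   : Pointwise (λ ℓ S → ∣ S ∣ ≡ ℓ ∸ 1) (descents path) labels
    hddCount   : hCount path + ddCount path ≡ k

-- (n+1) · N_d(n,k) = C(n+1,k+1) · C(n + (n-k)(d-2) + 1, k)
-- (when k > n both sides are 0, as C(n+1,k+1) = 0)
NdNumerator : ℕ → ℕ → ℕ → ℕ
NdNumerator d n k = (suc n C suc k) * ((n + (n ∸ k) * (d ∸ 2) + 1) C k)

-- Put an extra U in front of a labelled Schröder path of semilength n and cut it before every U and
-- H step: this gives n + 1 blocks, each a first step (U or H) followed by a possibly empty labelled
-- descent. Measured against a single U, a block costs one for a nonempty descent plus its number of
-- H and DD. The block words of paths are exactly the words of n + 1 blocks of total cost n whose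
-- nonempty prefixes all end strictly above the start, and by the cycle lemma every word of n + 1
-- blocks of total cost n has exactly one rotation of this kind. Hence (n + 1) N_d(n, k) counts all
-- words of n + 1 blocks with n - k descents and k occurrences of H and DD; such a word is a choice of
-- the n - k blocks with a descent together with a bit string of length n + 1 + (n - k)(d - 2) with
-- k ones, recording the H steps and the labels.
module Submission where

open import Data.Nat using (ℕ; zero; suc)

module Cardinality where

  open import Data.Nat using (_+_; _*_)
  open import Data.Bool using (Bool; true; false; T; if_then_else_)
  open import Data.Empty using (⊥-elim)
  open import Data.Fin using (Fin; zero; suc)
  open import Data.Fin.Properties using (+↔⊎; *↔×; 1↔⊤)
  open import Data.Product using (Σ; Σ-syntax; _×_; _,_; proj₁)
  open import Data.Product.Function.Dependent.Propositional using (Σ-↔)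
  open import Data.Product.Function.NonDependent.Propositional using (_×-↔_)
  open import Data.Sum using (_⊎_; inj₁; inj₂)
  open import Data.Sum.Function.Propositional using (_⊎-↔_)
  open import Function using (_∘_)
  open import Function.Bundles using (_↔_; mk↔ₛ′; Inverse)
  open import Function.Related.Propositional using (K-reflexive)
  open import Function.Properties.Inverse using (↔-refl; ↔-sym; ↔-trans)
  open import Relation.Nullary using (¬_)
  open import Relation.Nullary.Irrelevant using (Irrelevant)
  open import Relation.Binary.PropositionalEquality

  private variable
    A B : Set
    m n : ℕ

  ×-irrelevant : Irrelevant A → Irrelevant B → Irrelevant (A × B)
  ×-irrelevant irrA irrB (a , b) (a′ , b′) = cong₂ _,_ (irrA a a′) (irrB b b′)

  Σ-≡-by-proj₁ : {P : A → Set} → (∀ {a} → Irrelevant (P a)) →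
                 {x y : Σ A P} → proj₁ x ≡ proj₁ y → x ≡ y
  Σ-≡-by-proj₁ irr {a , p} {.a , q} refl = cong (a ,_) (irr p q)

  Fin-cong : m ≡ n → Fin m ↔ Fin n
  Fin-cong refl = ↔-refl

  ¬↔Fin0 : ¬ A → A ↔ Fin 0
  ¬↔Fin0 ¬a = mk↔ₛ′ (λ a → ⊥-elim (¬a a)) (λ ()) (λ ()) (λ a → ⊥-elim (¬a a))

  ⊎↔Fin+ : A ↔ Fin m → B ↔ Fin n → (A ⊎ B) ↔ Fin (m + n)
  ⊎↔Fin+ f g = ↔-trans (f ⊎-↔ g) (↔-sym +↔⊎)

  ×↔Fin* : A ↔ Fin m → B ↔ Fin n → (A × B) ↔ Fin (m * n)
  ×↔Fin* f g = ↔-trans (f ×-↔ g) (↔-sym *↔×)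

  count : (Fin n → Bool) → ℕ
  count {zero}  P = 0
  count {suc n} P = (if P zero then 1 else 0) + count (P ∘ suc)

  T↔Fin : ∀ b → T b ↔ Fin (if b then 1 else 0)
  T↔Fin true  = ↔-sym 1↔⊤
  T↔Fin false = ¬↔Fin0 (λ ())

  Σ-Fin↔count : (P : Fin n → Bool) → Σ (Fin n) (T ∘ P) ↔ Fin (count P)
  Σ-Fin↔count {zero}  P = ¬↔Fin0 (λ ())
  Σ-Fin↔count {suc n} P = ↔-trans split (⊎↔Fin+ (T↔Fin (P zero)) (Σ-Fin↔count (P ∘ suc)))
    where
    split : Σ (Fin (suc n)) (T ∘ P) ↔ (T (P zero) ⊎ Σ (Fin n) (T ∘ P ∘ suc))
    split = mk↔ₛ′
      (λ { (zero , p) → inj₁ p ; (suc i , p) → inj₂ (i , p) })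
      (λ { (inj₁ p) → zero , p ; (inj₂ (i , p)) → suc i , p })
      (λ { (inj₁ p) → refl ; (inj₂ (i , p)) → refl })
      (λ { (zero , p) → refl ; (suc i , p) → refl })

  finite-subtype : A ↔ Fin n → (P : A → Bool) → Σ[ c ∈ ℕ ] (Σ A (T ∘ P) ↔ Fin c)
  finite-subtype f P = count (P ∘ from) , ↔-trans (Σ-↔ f fibre) (Σ-Fin↔count (P ∘ from))
    where
    open Inverse f
    fibre : ∀ {a} → T (P a) ↔ T (P (from (to a)))
    fibre {a} = K-reflexive (cong (T ∘ P) (sym (strictlyInverseʳ a)))

module Lists {A : Set} where

  open import Data.Nat using (ℕ; suc; _+_; _<_; s≤s)
  open import Data.Nat.Properties using (+-comm; m≤n+m; +-commutativeSemigroup)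
  open import Algebra.Properties.CommutativeSemigroup +-commutativeSemigroup using (interchange)
  open import Data.List using (List; []; _∷_; _++_; length; map; take; drop)
  open import Data.List.Properties
    using (map-++; length-++; length-++-comm; length-++-sucʳ; length-++-≤ˡ; ∷-injective; take++drop≡id)
  open import Data.Nat.ListAction using (sum)
  open import Data.Nat.ListAction.Properties using (sum-++)
  open import Data.Product using (Σ-syntax; _×_; _,_)
  open import Data.Sum using (_⊎_; inj₁; inj₂)
  open import Relation.Binary.PropositionalEquality

  weight : (A → ℕ) → List A → ℕ
  weight f xs = sum (map f xs)

  weight-++ : ∀ f (xs ys : List A) → weight f (xs ++ ys) ≡ weight f xs + weight f ys
  weight-++ f xs ys = trans (cong sum (map-++ f xs ys)) (sum-++ (map f xs) (map f ys))

  weight-++-comm : ∀ f (xs ys : List A) → weight f (xs ++ ys) ≡ weight f (ys ++ xs)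
  weight-++-comm f xs ys = begin
    weight f (xs ++ ys)         ≡⟨ weight-++ f xs ys ⟩
    weight f xs + weight f ys   ≡⟨ +-comm (weight f xs) _ ⟩
    weight f ys + weight f xs   ≡⟨ weight-++ f ys xs ⟨
    weight f (ys ++ xs)         ∎
    where open ≡-Reasoning

  weight-cong : ∀ {f g} → (∀ x → f x ≡ g x) → ∀ (xs : List A) → weight f xs ≡ weight g xs
  weight-cong f≗g []       = refl
  weight-cong f≗g (x ∷ xs) = cong₂ _+_ (f≗g x) (weight-cong f≗g xs)

  weight-+ : ∀ f g (xs : List A) → weight (λ x → f x + g x) xs ≡ weight f xs + weight g xs
  weight-+ f g []       = refl
  weight-+ f g (x ∷ xs) =
    trans (cong (f x + g x +_) (weight-+ f g xs)) (interchange (f x) (g x) (weight f xs) (weight g xs))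

  prefix-length-< : ∀ (xs : List A) y ys → length xs < length (xs ++ y ∷ ys)
  prefix-length-< xs y ys rewrite length-++-sucʳ xs y ys = s≤s (length-++-≤ˡ xs)

  suffix-length-< : ∀ (xs : List A) y ys → length ys < length (xs ++ y ∷ ys)
  suffix-length-< xs y ys rewrite length-++ xs {y ∷ ys} = m≤n+m (suc (length ys)) (length xs)

  ++-overlap : ∀ (xs ys us vs : List A) → xs ++ ys ≡ us ++ vs →
               Σ[ m ∈ List A ] ((us ≡ xs ++ m × ys ≡ m ++ vs) ⊎ (xs ≡ us ++ m × vs ≡ m ++ ys))
  ++-overlap []       ys us       vs eq = us , inj₁ (refl , eq)
  ++-overlap (x ∷ xs) ys []       vs eq = x ∷ xs , inj₂ (refl , sym eq)
  ++-overlap (x ∷ xs) ys (u ∷ us) vs eq with refl , eq′ ← ∷-injective eq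
    with ++-overlap xs ys us vs eq′
  ... | m , inj₁ (p , q) = m , inj₁ (cong (x ∷_) p , q)
  ... | m , inj₂ (p , q) = m , inj₂ (cong (x ∷_) p , q)

  take-length-++ : ∀ (xs ys : List A) → take (length xs) (xs ++ ys) ≡ xs
  take-length-++ []       ys = refl
  take-length-++ (x ∷ xs) ys = cong (x ∷_) (take-length-++ xs ys)

  drop-length-++ : ∀ (xs ys : List A) → drop (length xs) (xs ++ ys) ≡ ys
  drop-length-++ []       ys = refl
  drop-length-++ (x ∷ xs) ys = drop-length-++ xs ys

  rotate : ℕ → List A → List A
  rotate i xs = drop i xs ++ take i xs

  rotate-++ : ∀ (xs ys : List A) → rotate (length xs) (xs ++ ys) ≡ ys ++ xs
  rotate-++ xs ys = cong₂ _++_ (drop-length-++ xs ys) (take-length-++ xs ys)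

  length-rotate : ∀ i (xs : List A) → length (rotate i xs) ≡ length xs
  length-rotate i xs = trans (length-++-comm (drop i xs) (take i xs)) (cong length (take++drop≡id i xs))

  weight-rotate : ∀ f i (xs : List A) → weight f (rotate i xs) ≡ weight f xs
  weight-rotate f i xs = trans (weight-++-comm f (drop i xs) (take i xs)) (cong (weight f) (take++drop≡id i xs))

module BitStrings where

  open import Data.Nat using (_+_)
  open import Data.Nat.Properties using (≡-irrelevant; suc-injective)
  open import Data.Nat.Combinatorics using (_C_; nCk+nC[k+1]≡[n+1]C[k+1])
  open import Data.Bool using (Bool; true; false)
  open import Data.Fin using (Fin; zero)
  open import Data.List using (List; []; _∷_; _++_; length)
  open import Data.Product using (Σ-syntax; _×_; _,_; proj₁)
  open import Data.Sum using (_⊎_; inj₁; inj₂)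
  open import Function.Bundles using (_↔_; mk↔ₛ′)
  open import Function.Properties.Inverse using (↔-trans)
  open import Relation.Binary.PropositionalEquality
  open Cardinality

  trues : List Bool → ℕ
  trues []           = 0
  trues (true ∷ bs)  = suc (trues bs)
  trues (false ∷ bs) = trues bs

  trues-++ : ∀ xs ys → trues (xs ++ ys) ≡ trues xs + trues ys
  trues-++ []           ys = refl
  trues-++ (true ∷ xs)  ys = cong suc (trues-++ xs ys)
  trues-++ (false ∷ xs) ys = trues-++ xs ys

  BitStrings : ℕ → ℕ → Set
  BitStrings m k = Σ[ bs ∈ List Bool ] length bs ≡ m × trues bs ≡ k

  bitStrings-≡ : ∀ {m k} {s t : BitStrings m k} → proj₁ s ≡ proj₁ t → s ≡ t
  bitStrings-≡ = Σ-≡-by-proj₁ (×-irrelevant ≡-irrelevant ≡-irrelevant)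

  private
    cons-false : ∀ {m} → BitStrings (suc m) 0 ↔ BitStrings m 0
    cons-false = mk↔ₛ′
      (λ { (false ∷ bs , len , tr) → bs , suc-injective len , tr ; (true ∷ _ , _ , ()) })
      (λ (bs , len , tr) → false ∷ bs , cong suc len , tr)
      (λ _ → bitStrings-≡ refl)
      (λ { (false ∷ _ , _ , _) → bitStrings-≡ refl ; (true ∷ _ , _ , ()) })

    cons : ∀ {m k} → BitStrings (suc m) (suc k) ↔ (BitStrings m k ⊎ BitStrings m (suc k))
    cons = mk↔ₛ′
      (λ { (true ∷ bs , len , tr) → inj₁ (bs , suc-injective len , suc-injective tr)
         ; (false ∷ bs , len , tr) → inj₂ (bs , suc-injective len , tr) })
      (λ { (inj₁ (bs , len , tr)) → true ∷ bs , cong suc len , cong suc tr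
         ; (inj₂ (bs , len , tr)) → false ∷ bs , cong suc len , tr })
      (λ { (inj₁ _) → cong inj₁ (bitStrings-≡ refl) ; (inj₂ _) → cong inj₂ (bitStrings-≡ refl) })
      (λ { (true ∷ _ , _ , _) → bitStrings-≡ refl ; (false ∷ _ , _ , _) → bitStrings-≡ refl })

  BitStrings↔Fin : ∀ m k → BitStrings m k ↔ Fin (m C k)
  BitStrings↔Fin zero    zero    = mk↔ₛ′ (λ _ → zero) (λ _ → [] , refl , refl)
    (λ { zero → refl }) (λ { ([] , refl , refl) → refl })
  BitStrings↔Fin zero    (suc k) = ¬↔Fin0 λ { ([] , _ , ()) }
  BitStrings↔Fin (suc m) zero    = ↔-trans cons-false (BitStrings↔Fin m zero)
  BitStrings↔Fin (suc m) (suc k) = ↔-trans cons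
    (↔-trans (⊎↔Fin+ (BitStrings↔Fin m k) (BitStrings↔Fin m (suc k))) (Fin-cong (nCk+nC[k+1]≡[n+1]C[k+1] m k)))

module CycleLemma {A : Set} (v : A → ℕ) where

  open import Data.Nat as ℕ using (ℕ; suc; _∸_; _≤ᵇ_; _≡ᵇ_; s≤s)
  import Data.Nat.Properties as ℕ
  open import Data.Integer
    using (ℤ; +_; 0ℤ; 1ℤ; _+_; _-_; -_; _⊖_; _≤_; _<_; _≤?_; +≤+)
  open import Data.Integer.Properties
    using ( ≤-refl; ≤-reflexive; ≤-trans; <⇒≤; ≤-<-trans; ≰⇒>; i<j⇒suc[i]≤j
          ; +-monoˡ-≤; +-monoʳ-≤; +-mono-≤; +-identityˡ; +-identityʳ; +-assoc; +-comm
          ; +-injective; pos-+; m-n≡m⊖n; ⊖-≥; drop‿+≤+; module ≤-Reasoning)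
  open import Data.Integer.Tactic.RingSolver using (solve-∀)
  open import Data.Bool using (Bool; T; _∧_)
  open import Data.Bool.Properties using (T-∧; T-irrelevant)
  open import Data.List using (List; []; _∷_; _++_; length; take; drop)
  open import Data.List.Properties
    using ( ++-assoc; ++-identityʳ; ++-cancelˡ; ∷-injectiveʳ; take++drop≡id
          ; length-++; length-++-sucʳ; length-++-comm; length-drop)
  open import Data.Fin using (Fin; toℕ; fromℕ<)
  open import Data.Fin.Properties using (toℕ-fromℕ<; toℕ-injective; toℕ≤pred[n])
  open import Data.Product using (Σ; Σ-syntax; _×_; _,_; proj₁; proj₂)
  open import Data.Sum using (inj₁; inj₂)
  open import Data.Empty using (⊥; ⊥-elim)
  open import Function.Bundles using (Equivalence; _⇔_; mk⇔; _↔_; mk↔ₛ′)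
  open import Relation.Nullary using (yes; no)
  open import Relation.Binary.PropositionalEquality
  open Lists
  open Cardinality using (Σ-≡-by-proj₁; ×-irrelevant)

  private
    add-sub : ∀ a b → a ≡ a + b - b
    add-sub = solve-∀

    +-cancelʳ-≡ : ∀ k {i j} → i + k ≡ j + k → i ≡ j
    +-cancelʳ-≡ k {i} {j} eq = trans (add-sub i k) (trans (cong (_- k) eq) (sym (add-sub j k)))

    +-cancelʳ-≤ : ∀ k {i j} → i + k ≤ j + k → i ≤ j
    +-cancelʳ-≤ k {i} {j} le =
      ≤-trans (≤-reflexive (add-sub i k)) (≤-trans (+-monoˡ-≤ (- k) le) (≤-reflexive (sym (add-sub j k))))

  rise : A → ℤ
  rise x = 1ℤ - + v x

  height : List A → ℤ
  height []      = 0ℤ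
  height (x ∷ w) = rise x + height w

  height-++ : ∀ xs ys → height (xs ++ ys) ≡ height xs + height ys
  height-++ []       ys = sym (+-identityˡ (height ys))
  height-++ (x ∷ xs) ys =
    trans (cong (_+_ (rise x)) (height-++ xs ys)) (sym (+-assoc (rise x) (height xs) (height ys)))

  height-++-comm : ∀ xs ys → height (xs ++ ys) ≡ height (ys ++ xs)
  height-++-comm xs ys =
    trans (height-++ xs ys) (trans (+-comm (height xs) (height ys)) (sym (height-++ ys xs)))

  height+weight : ∀ w → height w + + weight v w ≡ + length w
  height+weight []      = refl
  height+weight (x ∷ w) = begin
    rise x + height w + + (v x ℕ.+ weight v w)
      ≡⟨ cong (_+_ (rise x + height w)) (pos-+ (v x) (weight v w)) ⟩
    rise x + height w + (+ v x + + weight v w)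
      ≡⟨ regroup (+ v x) (height w) (+ weight v w) ⟩
    1ℤ + (height w + + weight v w)
      ≡⟨ cong (_+_ 1ℤ) (height+weight w) ⟩
    + suc (length w) ∎
    where
    open ≡-Reasoning
    regroup : ∀ a h c → (1ℤ - a) + h + (a + c) ≡ 1ℤ + (h + c)
    regroup = solve-∀

  height≡1⇔ : ∀ w → height w ≡ 1ℤ ⇔ suc (weight v w) ≡ length w
  height≡1⇔ w = mk⇔
    (λ h≡1 → +-injective (trans (cong (_+ + weight v w) (sym h≡1)) (height+weight w)))
    (λ eq → +-cancelʳ-≡ (+ weight v w) (trans (height+weight w) (cong +_ (sym eq))))

  ballot : ℕ → List A → Bool
  ballot h []      = h ≡ᵇ 1
  ballot h (x ∷ w) = (v x ≤ᵇ h) ∧ ballot (suc h ∸ v x) w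

  PrefixPositive : ℕ → List A → Set
  PrefixPositive h w = ∀ a p q → w ≡ a ∷ p ++ q → 1ℤ ≤ + h + height (a ∷ p)

  private
    credit-step : ∀ {h} x → v x ℕ.≤ h → + h + rise x ≡ + (suc h ∸ v x)
    credit-step {h} x le = begin
      + h + (1ℤ - + v x) ≡⟨ shift (+ h) (+ v x) ⟩
      + suc h - + v x    ≡⟨ m-n≡m⊖n (suc h) (v x) ⟩
      suc h ⊖ v x        ≡⟨ ⊖-≥ (ℕ.m≤n⇒m≤1+n le) ⟩
      + (suc h ∸ v x)    ∎
      where
      open ≡-Reasoning
      shift : ∀ a b → a + (1ℤ - b) ≡ (1ℤ + a) - b
      shift = solve-∀

    credit-step-+ : ∀ {h} x → v x ℕ.≤ h → ∀ s → + h + (rise x + s) ≡ + (suc h ∸ v x) + s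
    credit-step-+ {h} x le s = trans (sym (+-assoc (+ h) (rise x) s)) (cong (_+ s) (credit-step x le))

    affordable : ∀ {h} x → 1ℤ ≤ + h + rise x → v x ℕ.≤ h
    affordable {h} x pos = drop‿+≤+ (+-cancelʳ-≤ 1ℤ (begin
      + v x + 1ℤ                ≤⟨ +-monoʳ-≤ (+ v x) pos ⟩
      + v x + (+ h + rise x)    ≡⟨ cancel (+ v x) (+ h) ⟩
      + h + 1ℤ                  ∎))
      where
      open ≤-Reasoning
      cancel : ∀ a b → a + (b + (1ℤ - a)) ≡ b + 1ℤ
      cancel = solve-∀

  ballot-sound : ∀ h w → T (ballot h w) → PrefixPositive h w × + h + height w ≡ 1ℤ
  ballot-sound h []      t = (λ _ _ _ ()) , trans (+-identityʳ (+ h)) (cong +_ (ℕ.≡ᵇ⇒≡ h 1 t))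
  ballot-sound h (x ∷ w) t with vx≤ᵇh , rest ← Equivalence.to T-∧ t
    with positive , total ← ballot-sound (suc h ∸ v x) w rest =
    positive′ , trans (credit-step-+ x le (height w)) total
    where
    le = ℕ.≤ᵇ⇒≤ (v x) h vx≤ᵇh
    positive′ : PrefixPositive h (x ∷ w)
    positive′ .x []      q refl = ≤-trans (+≤+ (ℕ.m<n⇒0<n∸m (s≤s le)))
                                          (≤-reflexive (sym (trans (credit-step-+ x le 0ℤ) (+-identityʳ _))))
    positive′ .x (a ∷ p) q refl = ≤-trans (positive a p q refl) (≤-reflexive (sym (credit-step-+ x le _)))

  ballot-complete : ∀ h w → PrefixPositive h w → + h + height w ≡ 1ℤ → T (ballot h w)
  ballot-complete h []      _        total =
    ℕ.≡⇒≡ᵇ h 1 (+-injective (trans (sym (+-identityʳ (+ h))) total))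
  ballot-complete h (x ∷ w) positive total = Equivalence.from T-∧ (ℕ.≤⇒≤ᵇ le , rest)
    where
    le : v x ℕ.≤ h
    le = affordable x (≤-trans (positive x [] w refl) (≤-reflexive (cong (_+_ (+ h)) (+-identityʳ (rise x)))))
    positive′ : PrefixPositive (suc h ∸ v x) w
    positive′ a p q refl = ≤-trans (positive x (a ∷ p) q refl) (≤-reflexive (credit-step-+ x le _))
    rest = ballot-complete (suc h ∸ v x) w positive′ (trans (sym (credit-step-+ x le (height w))) total)

  Dominating : List A → Set
  Dominating w = T (ballot 0 w)

  dominating-prefix : ∀ w → Dominating w → ∀ a p q → w ≡ a ∷ p ++ q → 1ℤ ≤ height (a ∷ p)
  dominating-prefix w dom a p q eq =
    ≤-trans (proj₁ (ballot-sound 0 w dom) a p q eq) (≤-reflexive (+-identityˡ (height (a ∷ p))))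

  dominating-height : ∀ w → Dominating w → height w ≡ 1ℤ
  dominating-height w dom = trans (sym (+-identityˡ (height w))) (proj₂ (ballot-sound 0 w dom))

  dominating-weight : ∀ w → Dominating w → suc (weight v w) ≡ length w
  dominating-weight w dom = Equivalence.to (height≡1⇔ w) (dominating-height w dom)

  dominating-intro : ∀ w → (∀ a p q → w ≡ a ∷ p ++ q → 1ℤ ≤ height (a ∷ p)) →
                     height w ≡ 1ℤ → Dominating w
  dominating-intro w positive total = ballot-complete 0 w
    (λ a p q eq → ≤-trans (positive a p q eq) (≤-reflexive (sym (+-identityˡ (height (a ∷ p))))))
    (trans (+-identityˡ (height w)) total)

  -- Both factors would have height at least 1, but their heights add up to 1.
  dominating-swap-absurd : ∀ a p b q → Dominating (a ∷ p ++ b ∷ q) → Dominating (b ∷ q ++ a ∷ p) → ⊥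
  dominating-swap-absurd a p b q dom dom′ with begin
    1ℤ + 1ℤ                         ≤⟨ +-mono-≤ (dominating-prefix _ dom a p (b ∷ q) refl)
                                                (dominating-prefix _ dom′ b q (a ∷ p) refl) ⟩
    height (a ∷ p) + height (b ∷ q) ≡⟨ height-++ (a ∷ p) (b ∷ q) ⟨
    height (a ∷ p ++ b ∷ q)         ≡⟨ dominating-height (a ∷ p ++ b ∷ q) dom ⟩
    1ℤ                              ∎
    where open ≤-Reasoning
  ... | +≤+ (s≤s ())

  GoodSplit : List A → Set
  GoodSplit w = Σ[ x ∈ List A ] Σ[ a ∈ A ] Σ[ y ∈ List A ] w ≡ x ++ a ∷ y × Dominating (a ∷ y ++ x)

  private
    no-overlap : ∀ {x m a y a′ y′} → a ∷ y ≡ m ++ a′ ∷ y′ →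
                 Dominating (a ∷ y ++ x) → Dominating (a′ ∷ y′ ++ x ++ m) → m ≡ []
    no-overlap {m = []} _ _ _ = refl
    no-overlap {x} {b ∷ m} {a′ = a′} {y′} refl dom dom′ = ⊥-elim
      (dominating-swap-absurd b m a′ (y′ ++ x)
        (subst Dominating (cong (b ∷_) (++-assoc m (a′ ∷ y′) x)) dom)
        (subst Dominating (cong (a′ ∷_) (sym (++-assoc y′ x (b ∷ m)))) dom′))

  good-split-unique : ∀ {x a y x′ a′ y′} → x ++ a ∷ y ≡ x′ ++ a′ ∷ y′ →
                      Dominating (a ∷ y ++ x) → Dominating (a′ ∷ y′ ++ x′) → x ≡ x′
  good-split-unique {x} {a} {y} {x′} {a′} {y′} eq dom dom′ with ++-overlap x (a ∷ y) x′ (a′ ∷ y′) eq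
  ... | m , inj₁ (refl , split) rewrite no-overlap split dom dom′ = sym (++-identityʳ x)
  ... | m , inj₂ (refl , split) rewrite no-overlap split dom′ dom = ++-identityʳ x′

  record HighestSuffix (w : List A) : Set where
    field
      prefix   : List A
      first    : A
      rest     : List A
      split    : w ≡ prefix ++ first ∷ rest
      highest  : ∀ q b s → w ≡ q ++ b ∷ s → height (b ∷ s) ≤ height (first ∷ rest)
      shortest : ∀ q b s → w ≡ q ++ b ∷ s → length s ℕ.< length rest →
                 height (b ∷ s) < height (first ∷ rest)

  highest-suffix : ∀ a w → HighestSuffix (a ∷ w)
  highest-suffix a [] = record
    { prefix = []; first = a; rest = []; split = refl; highest = highest; shortest = λ _ _ _ _ () }
    where
    highest : ∀ q b s → a ∷ [] ≡ q ++ b ∷ s → height (b ∷ s) ≤ height (a ∷ [])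
    highest []          _ _ refl = ≤-refl
    highest (_ ∷ [])    _ _ ()
    highest (_ ∷ _ ∷ _) _ _ ()
  highest-suffix a (b ∷ w) = extend (highest-suffix b w)
    where
    extend : HighestSuffix (b ∷ w) → HighestSuffix (a ∷ b ∷ w)
    extend r with height (a ∷ b ∷ w) ≤? height (first ∷ rest)
      where open HighestSuffix r
    ... | yes whole≤ = record
      { prefix = a ∷ prefix; first = first; rest = rest; split = cong (a ∷_) split
      ; highest = highest′; shortest = shortest′ }
      where
      open HighestSuffix r
      highest′ : ∀ q c s → a ∷ b ∷ w ≡ q ++ c ∷ s → height (c ∷ s) ≤ height (first ∷ rest)
      highest′ []      _ _ refl = whole≤
      highest′ (_ ∷ q) c s eq   = highest q c s (∷-injectiveʳ eq)
      shortest′ : ∀ q c s → a ∷ b ∷ w ≡ q ++ c ∷ s → length s ℕ.< length rest →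
                  height (c ∷ s) < height (first ∷ rest)
      shortest′ []      _ _ refl lt = ⊥-elim (ℕ.<-asym lt
        (subst (λ u → length rest ℕ.< length u) (sym split) (suffix-length-< prefix first rest)))
      shortest′ (_ ∷ q) c s eq   lt = shortest q c s (∷-injectiveʳ eq) lt
    ... | no whole≰ = record
      { prefix = []; first = a; rest = b ∷ w; split = refl; highest = highest′; shortest = shortest′ }
      where
      open HighestSuffix r
      highest′ : ∀ q c s → a ∷ b ∷ w ≡ q ++ c ∷ s → height (c ∷ s) ≤ height (a ∷ b ∷ w)
      highest′ []      _ _ refl = ≤-refl
      highest′ (_ ∷ q) c s eq   = ≤-trans (highest q c s (∷-injectiveʳ eq)) (<⇒≤ (≰⇒> whole≰))
      shortest′ : ∀ q c s → a ∷ b ∷ w ≡ q ++ c ∷ s → length s ℕ.< length (b ∷ w) →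
                  height (c ∷ s) < height (a ∷ b ∷ w)
      shortest′ []      _ _ refl lt = ⊥-elim (ℕ.<-irrefl refl lt)
      shortest′ (_ ∷ q) c s eq   _  = ≤-<-trans (highest q c s (∷-injectiveʳ eq)) (≰⇒> whole≰)

  highest-suffix-dominating : ∀ a w (r : HighestSuffix (a ∷ w)) → height (a ∷ w) ≡ 1ℤ →
    let open HighestSuffix r in Dominating (first ∷ rest ++ prefix)
  highest-suffix-dominating a w r total = dominating-intro (Y ++ prefix) positive rotated-total
    where
    open HighestSuffix r
    open ≤-Reasoning
    Y = first ∷ rest

    rotated-total : height (Y ++ prefix) ≡ 1ℤ
    rotated-total = trans (height-++-comm Y prefix) (trans (cong height (sym split)) total)

    -- A prefix of Y ++ prefix either extends beyond Y (then compare the remaining suffix of w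
    -- with Y) or is a proper part of Y (then its complement in Y is a shorter suffix of w).
    positive : ∀ c p q → Y ++ prefix ≡ c ∷ p ++ q → 1ℤ ≤ height (c ∷ p)
    positive c p []      eq = ≤-reflexive (sym (begin-equality
      height (c ∷ p)        ≡⟨ cong height (sym (++-identityʳ (c ∷ p))) ⟩
      height (c ∷ p ++ [])  ≡⟨ cong height (sym eq) ⟩
      height (Y ++ prefix)  ≡⟨ rotated-total ⟩
      1ℤ                    ∎))
    positive c p (d ∷ q) eq with ++-overlap Y prefix (c ∷ p) (d ∷ q) eq
    ... | m , inj₁ (c∷p≡Y++m , prefix≡m++d∷q) = begin
      1ℤ                              ≡⟨ sym total ⟩
      height (a ∷ w)                  ≡⟨ cong height w≡ ⟩
      height (m ++ d ∷ q ++ Y)        ≡⟨ height-++ m (d ∷ q ++ Y) ⟩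
      height m + height (d ∷ q ++ Y)  ≤⟨ +-monoʳ-≤ (height m) (highest m d (q ++ Y) w≡) ⟩
      height m + height Y             ≡⟨ +-comm (height m) (height Y) ⟩
      height Y + height m             ≡⟨ sym (height-++ Y m) ⟩
      height (Y ++ m)                 ≡⟨ cong height (sym c∷p≡Y++m) ⟩
      height (c ∷ p)                  ∎
      where
      w≡ : a ∷ w ≡ m ++ d ∷ q ++ Y
      w≡ = trans split (trans (cong (_++ Y) prefix≡m++d∷q) (++-assoc m (d ∷ q) Y))
    ... | [] , inj₂ (Y≡c∷p++[] , _) = begin
      1ℤ              ≡⟨ sym total ⟩
      height (a ∷ w)  ≤⟨ highest [] a w refl ⟩
      height Y        ≡⟨ cong height (trans Y≡c∷p++[] (++-identityʳ (c ∷ p))) ⟩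
      height (c ∷ p)  ∎
    ... | e ∷ m , inj₂ (refl , _) = +-cancelʳ-≤ (height (e ∷ m)) (i<j⇒suc[i]≤j (begin-strict
      height (e ∷ m)                  <⟨ shortest (prefix ++ c ∷ p) e m w≡ (suffix-length-< p e m) ⟩
      height (c ∷ p ++ e ∷ m)         ≡⟨ height-++ (c ∷ p) (e ∷ m) ⟩
      height (c ∷ p) + height (e ∷ m) ∎))
      where
      w≡ : a ∷ w ≡ (prefix ++ c ∷ p) ++ e ∷ m
      w≡ = trans split (sym (++-assoc prefix (c ∷ p) (e ∷ m)))

  good-split : ∀ a w → height (a ∷ w) ≡ 1ℤ → GoodSplit (a ∷ w)
  good-split a w total = prefix , first , rest , split , highest-suffix-dominating a w r total
    where
    r = highest-suffix a w
    open HighestSuffix r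

  module _ (f : A → ℕ) (n k : ℕ) where

    DominatingWords : Set
    DominatingWords = Σ[ w ∈ List A ] length w ≡ suc n × Dominating w × weight f w ≡ k

    BalancedWords : Set
    BalancedWords = Σ[ w ∈ List A ] length w ≡ suc n × weight v w ≡ n × weight f w ≡ k

    dominating-words-≡ : {u u′ : DominatingWords} → proj₁ u ≡ proj₁ u′ → u ≡ u′
    dominating-words-≡ =
      Σ-≡-by-proj₁ (×-irrelevant ℕ.≡-irrelevant (×-irrelevant T-irrelevant ℕ.≡-irrelevant))

    balanced-words-≡ : {w w′ : BalancedWords} → proj₁ w ≡ proj₁ w′ → w ≡ w′
    balanced-words-≡ =
      Σ-≡-by-proj₁ (×-irrelevant ℕ.≡-irrelevant (×-irrelevant ℕ.≡-irrelevant ℕ.≡-irrelevant))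

    DominatingWords↔Σ : DominatingWords ↔ Σ BalancedWords (λ w → Dominating (proj₁ w))
    DominatingWords↔Σ = mk↔ₛ′
      (λ (u , len , dom , wf) → (u , len , ℕ.suc-injective (trans (dominating-weight u dom) len) , wf) , dom)
      (λ ((u , len , _ , wf) , dom) → u , len , dom , wf)
      (λ _ → Σ-≡-by-proj₁ T-irrelevant (balanced-words-≡ refl))
      (λ _ → refl)

    private
      -- The last toℕ i letters of u are moved to the front.
      rotate-back : Fin (suc n) × DominatingWords → BalancedWords
      rotate-back (i , u , len , dom , wf) =
        rotate j u ,
        trans (length-rotate j u) len ,
        trans (weight-rotate v j u) (ℕ.suc-injective (trans (dominating-weight u dom) len)) ,
        trans (weight-rotate f j u) wf
        where j = suc (n ∸ toℕ i)

      prefix-index : ∀ (x : List A) a y → length (x ++ a ∷ y) ≡ suc n → Fin (suc n)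
      prefix-index x a y len = fromℕ< (subst (length x ℕ.<_) len (prefix-length-< x a y))

      unrotate : (w : BalancedWords) → GoodSplit (proj₁ w) → Fin (suc n) × DominatingWords
      unrotate (w , len , _ , wf) (x , a , y , split , dom) =
        prefix-index x a y len′ ,
        a ∷ y ++ x , trans (length-++-comm (a ∷ y) x) len′ , dom ,
        trans (weight-++-comm f (a ∷ y) x) (trans (cong (weight f) (sym split)) wf)
        where
        len′ : length (x ++ a ∷ y) ≡ suc n
        len′ = trans (cong length (sym split)) len

      balanced-good-split : (w : BalancedWords) → GoodSplit (proj₁ w)
      balanced-good-split (a ∷ w , len , wv , _) =
        good-split a w (Equivalence.from (height≡1⇔ (a ∷ w)) (trans (cong suc wv) (sym len)))

      rotate-back-unrotate : ∀ w sp → rotate-back (unrotate w sp) ≡ w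
      rotate-back-unrotate (.(x ++ a ∷ y) , len , _ , _) (x , a , y , refl , _) = balanced-words-≡ (begin
        rotate (suc (n ∸ toℕ (prefix-index x a y len))) (a ∷ y ++ x)
          ≡⟨ cong (λ i → rotate (suc (n ∸ i)) (a ∷ y ++ x)) (toℕ-fromℕ< {m = length x} _) ⟩
        rotate (suc (n ∸ length x)) (a ∷ y ++ x)
          ≡⟨ cong (λ i → rotate (suc i) (a ∷ y ++ x)) n∸x≡y ⟩
        rotate (length (a ∷ y)) ((a ∷ y) ++ x)
          ≡⟨ rotate-++ (a ∷ y) x ⟩
        x ++ a ∷ y ∎)
        where
        open ≡-Reasoning
        n∸x≡y : n ∸ length x ≡ length y
        n∸x≡y = begin
          n ∸ length x
            ≡⟨ cong (_∸ length x) (ℕ.suc-injective (trans (sym (length-++-sucʳ x a y)) len)) ⟨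
          length (x ++ y) ∸ length x
            ≡⟨ cong (_∸ length x) (length-++ x) ⟩
          length x ℕ.+ length y ∸ length x
            ≡⟨ ℕ.m+n∸m≡n (length x) (length y) ⟩
          length y ∎

      unrotate-rotate-back : ∀ u sp → unrotate (rotate-back u) sp ≡ u
      unrotate-rotate-back (i , c ∷ u , len , dom , _) (x , a , y , split , dom′) =
        cong₂ _,_ (toℕ-injective (trans (toℕ-fromℕ< {m = length x} _) (trans (cong length x≡) length-drop≡i)))
          (dominating-words-≡ rotated≡)
        where
        open ≡-Reasoning
        j = n ∸ toℕ i
        x≡ : x ≡ drop j u
        x≡ = good-split-unique (sym split) dom′
               (subst (λ t → Dominating (c ∷ t)) (sym (take++drop≡id j u)) dom)
        y≡ : a ∷ y ≡ c ∷ take j u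
        y≡ = ++-cancelˡ x (a ∷ y) (c ∷ take j u) (trans (sym split) (cong (_++ c ∷ take j u) (sym x≡)))
        rotated≡ : a ∷ y ++ x ≡ c ∷ u
        rotated≡ = begin
          (a ∷ y) ++ x               ≡⟨ cong₂ _++_ y≡ x≡ ⟩
          (c ∷ take j u) ++ drop j u ≡⟨ cong (c ∷_) (take++drop≡id j u) ⟩
          c ∷ u                      ∎
        length-drop≡i : length (drop j u) ≡ toℕ i
        length-drop≡i = begin
          length (drop j u)  ≡⟨ length-drop j u ⟩
          length u ∸ j       ≡⟨ cong (_∸ j) (ℕ.suc-injective len) ⟩
          n ∸ (n ∸ toℕ i)    ≡⟨ ℕ.m∸[m∸n]≡n (toℕ≤pred[n] i) ⟩
          toℕ i              ∎

    cycle-lemma : (Fin (suc n) × DominatingWords) ↔ BalancedWords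
    cycle-lemma = mk↔ₛ′ rotate-back (λ w → unrotate w (balanced-good-split w))
      (λ w → rotate-back-unrotate w (balanced-good-split w))
      (λ u → unrotate-rotate-back u (balanced-good-split (rotate-back u)))

module Blocks (e : ℕ) where

  open import Data.Nat using (_+_; _*_; _≤_; s≤s)
  open import Data.Nat.Properties
    using (≡-irrelevant; suc-injective; +-assoc; *-identityˡ; m≤m+n; +-cancelˡ-≡)
  open import Data.Nat.Tactic.RingSolver using (solve-∀)
  open import Data.Nat.Combinatorics using (_C_)
  open import Data.Bool using (Bool; true; false; if_then_else_)
  open import Data.Maybe using (Maybe; just; nothing; is-just)
  open import Data.Vec using (Vec; []; _∷_; toList; replicate)
  open import Data.Vec.Properties using (length-toList)
  open import Data.Fin using (Fin)
  open import Data.Fin.Subset using (Subset; ∣_∣)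
  open import Data.List using (List; []; _∷_; _++_; length; map)
  open import Data.List.Properties using (length-map; length-++)
  open import Data.Product using (Σ-syntax; _×_; _,_; proj₁; proj₂)
  open import Function using (_∘_)
  open import Function.Bundles using (_↔_; mk↔ₛ′)
  open import Function.Properties.Inverse using (↔-trans)
  open import Relation.Binary.PropositionalEquality
  open Cardinality
  open BitStrings
  open Lists

  -- A block is a first step, U (false) or H (true), followed by a descent that is either empty
  -- (nothing) or has length 1 + ∣ S ∣ and label S (just S).
  Block : Set
  Block = Bool × Maybe (Subset e)

  bit : Bool → ℕ
  bit b = if b then 1 else 0

  labelSize : Maybe (Subset e) → ℕ
  labelSize nothing  = 0
  labelSize (just S) = ∣ S ∣

  descentLength : Maybe (Subset e) → ℕ
  descentLength m = bit (is-just m) + labelSize m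

  hasDescent : Block → ℕ
  hasDescent (_ , m) = bit (is-just m)

  -- A descent of length 1 + ∣ S ∣ contains ∣ S ∣ factors DD.
  hdd : Block → ℕ
  hdd (b , m) = bit b + labelSize m

  -- The height lost by a block, compared with a single up step.
  cost : Block → ℕ
  cost (b , m) = bit b + descentLength m

  weight-cost : ∀ w → weight cost w ≡ weight hasDescent w + weight hdd w
  weight-cost w = trans (weight-cong (λ (b , m) → regroup (bit b) (bit (is-just m)) (labelSize m)) w)
                        (weight-+ hasDescent hdd w)
    where
    regroup : ∀ h j s → h + (j + s) ≡ j + (h + s)
    regroup = solve-∀

  flags : List Block → List Bool
  flags = map (is-just ∘ proj₂)

  labelBits : Maybe (Subset e) → List Bool
  labelBits nothing  = []
  labelBits (just S) = toList S

  bits : List Block → List Bool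
  bits []            = []
  bits ((b , m) ∷ w) = b ∷ labelBits m ++ bits w

  -- On bit strings too short to encode blocks, splitLabel pads with false and decode stops early.
  splitLabel : ∀ m → List Bool → Vec Bool m × List Bool
  splitLabel zero    bs       = [] , bs
  splitLabel (suc m) []       = replicate (suc m) false , []
  splitLabel (suc m) (b ∷ bs) = let S , rest = splitLabel m bs in b ∷ S , rest

  decode : List Bool → List Bool → List Block
  decode []          _       = []
  decode (_ ∷ _)     []      = []
  decode (false ∷ F) (b ∷ D) = (b , nothing) ∷ decode F D
  decode (true ∷ F)  (b ∷ D) = let S , D′ = splitLabel e D in (b , just S) ∷ decode F D′

  trues-∷ : ∀ b bs → trues (b ∷ bs) ≡ bit b + trues bs
  trues-∷ true  bs = refl
  trues-∷ false bs = refl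

  trues-toList : ∀ {m} (S : Subset m) → trues (toList S) ≡ ∣ S ∣
  trues-toList []          = refl
  trues-toList (true ∷ S)  = cong suc (trues-toList S)
  trues-toList (false ∷ S) = trues-toList S

  trues-labelBits : ∀ m → trues (labelBits m) ≡ labelSize m
  trues-labelBits nothing  = refl
  trues-labelBits (just S) = trues-toList S

  length-labelBits : ∀ m → length (labelBits m) ≡ bit (is-just m) * e
  length-labelBits nothing  = refl
  length-labelBits (just S) = trans (length-toList S) (sym (*-identityˡ e))

  trues-flags : ∀ w → trues (flags w) ≡ weight hasDescent w
  trues-flags []            = refl
  trues-flags ((_ , m) ∷ w) =
    trans (trues-∷ (is-just m) (flags w)) (cong (bit (is-just m) +_) (trues-flags w))

  trues-bits : ∀ w → trues (bits w) ≡ weight hdd w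
  trues-bits []            = refl
  trues-bits ((b , m) ∷ w) = begin
    trues (b ∷ labelBits m ++ bits w)
      ≡⟨ trues-∷ b (labelBits m ++ bits w) ⟩
    bit b + trues (labelBits m ++ bits w)
      ≡⟨ cong (bit b +_) (trues-++ (labelBits m) (bits w)) ⟩
    bit b + (trues (labelBits m) + trues (bits w))
      ≡⟨ cong₂ (λ s t → bit b + (s + t)) (trues-labelBits m) (trues-bits w) ⟩
    bit b + (labelSize m + weight hdd w)
      ≡⟨ +-assoc (bit b) (labelSize m) (weight hdd w) ⟨
    bit b + labelSize m + weight hdd w ∎
    where open ≡-Reasoning

  length-bits : ∀ w → length (bits w) ≡ length w + weight hasDescent w * e
  length-bits []            = refl
  length-bits ((_ , m) ∷ w) = cong suc (begin
    length (labelBits m ++ bits w)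
      ≡⟨ length-++ (labelBits m) ⟩
    length (labelBits m) + length (bits w)
      ≡⟨ cong₂ _+_ (length-labelBits m) (length-bits w) ⟩
    bit (is-just m) * e + (length w + weight hasDescent w * e)
      ≡⟨ regroup e (bit (is-just m)) (length w) (weight hasDescent w) ⟩
    length w + (bit (is-just m) + weight hasDescent w) * e ∎)
    where
    open ≡-Reasoning
    regroup : ∀ e j l d → j * e + (l + d * e) ≡ l + (j + d) * e
    regroup = solve-∀

  splitLabel-toList : ∀ {m} (S : Vec Bool m) D → splitLabel m (toList S ++ D) ≡ (S , D)
  splitLabel-toList []      D = refl
  splitLabel-toList (b ∷ S) D rewrite splitLabel-toList S D = refl

  splitLabel-spec : ∀ m D → m ≤ length D →
                    toList (proj₁ (splitLabel m D)) ++ proj₂ (splitLabel m D) ≡ D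
  splitLabel-spec zero    D       _         = refl
  splitLabel-spec (suc m) (b ∷ D) (s≤s m≤D) = cong (b ∷_) (splitLabel-spec m D m≤D)

  decode-encode : ∀ w → decode (flags w) (bits w) ≡ w
  decode-encode []                  = refl
  decode-encode ((b , nothing) ∷ w) = cong (_ ∷_) (decode-encode w)
  decode-encode ((b , just S) ∷ w) rewrite splitLabel-toList S (bits w) = cong (_ ∷_) (decode-encode w)

  encode-decode : ∀ F D → length D ≡ length F + trues F * e →
                  flags (decode F D) ≡ F × bits (decode F D) ≡ D
  encode-decode []          []      _   = refl , refl
  encode-decode []          (_ ∷ _) ()
  encode-decode (_ ∷ _)     []      ()
  encode-decode (false ∷ F) (b ∷ D) len with flags≡ , bits≡ ← encode-decode F D (suc-injective len) =
    cong (false ∷_) flags≡ , cong (b ∷_) bits≡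
  encode-decode (true ∷ F)  (b ∷ D) len =
    cong (true ∷_) (proj₁ rest≡) , cong (b ∷_) (trans (cong (toList S ++_) (proj₂ rest≡)) D≡)
    where
    S = proj₁ (splitLabel e D)
    D′ = proj₂ (splitLabel e D)
    len′ : length D ≡ e + (length F + trues F * e)
    len′ = trans (suc-injective len) (regroup (length F) (trues F) e)
      where
      regroup : ∀ l t e → l + (1 + t) * e ≡ e + (l + t * e)
      regroup = solve-∀
    D≡ : toList S ++ D′ ≡ D
    D≡ = splitLabel-spec e D (subst (e ≤_) (sym len′) (m≤m+n e _))
    rest≡ = encode-decode F D′ (+-cancelˡ-≡ e _ _ (begin
      e + length D′                 ≡⟨ cong (_+ length D′) (length-toList S) ⟨
      length (toList S) + length D′ ≡⟨ length-++ (toList S) ⟨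
      length (toList S ++ D′)       ≡⟨ cong length D≡ ⟩
      length D                      ≡⟨ len′ ⟩
      e + (length F + trues F * e)  ∎))
      where open ≡-Reasoning

  BlockWords : ℕ → ℕ → ℕ → Set
  BlockWords L j k = Σ[ w ∈ List Block ] length w ≡ L × weight hasDescent w ≡ j × weight hdd w ≡ k

  blockWords-≡ : ∀ {L j k} {w w′ : BlockWords L j k} → proj₁ w ≡ proj₁ w′ → w ≡ w′
  blockWords-≡ = Σ-≡-by-proj₁ (×-irrelevant ≡-irrelevant (×-irrelevant ≡-irrelevant ≡-irrelevant))

  BlockWords↔Fin : ∀ L j k → BlockWords L j k ↔ Fin ((L C j) * ((L + j * e) C k))
  BlockWords↔Fin L j k =
    ↔-trans encoding (×↔Fin* (BitStrings↔Fin L j) (BitStrings↔Fin (L + j * e) k))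
    where
    Codes = BitStrings L j × BitStrings (L + j * e) k

    encode : BlockWords L j k → Codes
    encode (w , len , d , h) =
      (flags w , trans (length-map _ w) len , trans (trues-flags w) d) ,
      (bits w , trans (length-bits w) (cong₂ (λ l d → l + d * e) len d) , trans (trues-bits w) h)

    round-trip : (((F , _) , (D , _)) : Codes) → flags (decode F D) ≡ F × bits (decode F D) ≡ D
    round-trip ((F , lenF , tF) , (D , lenD , _)) =
      encode-decode F D (trans lenD (sym (cong₂ (λ l t → l + t * e) lenF tF)))

    decode′ : Codes → BlockWords L j k
    decode′ c@((F , lenF , tF) , (D , lenD , tD)) with flags≡ , bits≡ ← round-trip c =
      decode F D ,
      trans (sym (length-map _ (decode F D))) (trans (cong length flags≡) lenF) ,
      trans (sym (trues-flags (decode F D))) (trans (cong trues flags≡) tF) ,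
      trans (sym (trues-bits (decode F D))) (trans (cong trues bits≡) tD)

    encoding : BlockWords L j k ↔ Codes
    encoding = mk↔ₛ′ encode decode′
      (λ c → cong₂ _,_ (bitStrings-≡ (proj₁ (round-trip c))) (bitStrings-≡ (proj₂ (round-trip c))))
      (λ (w , _) → blockWords-≡ (decode-encode w))

-- Here d = e + 2, so that labels are subsets of Fin e.
module SchröderPaths (e : ℕ) where

  open import Defs
  open import Data.Nat using (_+_; _*_; _∸_; _≤_; _≤ᵇ_; s≤s)
  open import Data.Nat.Properties
    using ( ≡-irrelevant; ≤-irrelevant; suc-injective; +-identityʳ; +-suc; +-∸-assoc; ≤ᵇ⇒≤
          ; *-cancelˡ-≡)
  open import Data.Nat.Tactic.RingSolver using (solve-∀)
  open import Data.Bool using (Bool; true; false; T; _∧_)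
  open import Data.Bool.Properties using (T-irrelevant)
  open import Data.Maybe using (just; nothing)
  open import Data.Fin.Subset using (Subset; ∣_∣)
  open import Data.Fin.Subset.Properties using (∣p∣≤n)
  open import Data.List using (List; []; _∷_; _++_; length; map; replicate)
  open import Data.List.Properties using (∷-injective; ∷-injectiveˡ; ∷-injectiveʳ)
  open import Data.List.Relation.Unary.All using (All; universal)
  import Data.List.Relation.Unary.All as All
  open import Data.List.Relation.Unary.All.Properties using (map⁺)
  open import Data.List.Relation.Binary.Pointwise using (Pointwise; []; _∷_)
  import Data.List.Relation.Binary.Pointwise.Properties as Pointwise
  open import Data.Product using (Σ-syntax; _×_; _,_; proj₁)
  open import Function using (_∘_)
  open import Function.Bundles using (_↔_; mk↔ₛ′)
  open import Relation.Binary.PropositionalEquality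
  open Cardinality using (Σ-≡-by-proj₁; ×-irrelevant)
  open Lists
  open Blocks e
  open CycleLemma cost

  stepOf : Bool → Step
  stepOf false = U
  stepOf true  = H

  toPath : List Block → List Step
  toPath []            = []
  toPath ((b , m) ∷ w) = stepOf b ∷ replicate (descentLength m) D ++ toPath w

  labelsOf : List Block → List (Subset e)
  labelsOf []                  = []
  labelsOf ((_ , nothing) ∷ w) = labelsOf w
  labelsOf ((_ , just S) ∷ w)  = S ∷ labelsOf w

  LabelsFit : List ℕ → List (Subset e) → Set
  LabelsFit = Pointwise (λ ℓ S → ∣ S ∣ ≡ ℓ ∸ 1)

  ∧-congˡ : ∀ a {x y} → (T a → x ≡ y) → a ∧ x ≡ a ∧ y
  ∧-congˡ true  x≡y = x≡y _
  ∧-congˡ false _   = refl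

  ≤ᵇ-suc : ∀ a h → (suc a ≤ᵇ suc h) ≡ (a ≤ᵇ h)
  ≤ᵇ-suc zero    h = refl
  ≤ᵇ-suc (suc a) h = refl

  staysAbove-stepOf : ∀ b h s → staysAbove h (stepOf b ∷ s) ≡ staysAbove (suc h ∸ bit b) s
  staysAbove-stepOf false zero    s = refl
  staysAbove-stepOf false (suc h) s = refl
  staysAbove-stepOf true  zero    s = refl
  staysAbove-stepOf true  (suc h) s = refl

  staysAbove-descent : ∀ a h s → staysAbove h (replicate a D ++ s) ≡ (a ≤ᵇ h) ∧ staysAbove (h ∸ a) s
  staysAbove-descent zero    h       s = refl
  staysAbove-descent (suc a) zero    s = refl
  staysAbove-descent (suc a) (suc h) s =
    trans (staysAbove-descent a h s) (cong (_∧ staysAbove (h ∸ a) s) (sym (≤ᵇ-suc a h)))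

  staysAbove-toPath : ∀ h w → staysAbove h (toPath w) ≡ ballot (suc h) w
  staysAbove-toPath zero    []            = refl
  staysAbove-toPath (suc h) []            = refl
  staysAbove-toPath h       ((b , m) ∷ w) = begin
    staysAbove h (stepOf b ∷ replicate a D ++ toPath w)
      ≡⟨ staysAbove-stepOf b h _ ⟩
    staysAbove (suc h ∸ bit b) (replicate a D ++ toPath w)
      ≡⟨ staysAbove-descent a (suc h ∸ bit b) _ ⟩
    (a ≤ᵇ suc h ∸ bit b) ∧ staysAbove (suc h ∸ bit b ∸ a) (toPath w)
      ≡⟨ cong ((a ≤ᵇ suc h ∸ bit b) ∧_) (staysAbove-toPath _ w) ⟩
    (a ≤ᵇ suc h ∸ bit b) ∧ ballot (suc (suc h ∸ bit b ∸ a)) w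
      ≡⟨ credit b ⟩
    (bit b + a ≤ᵇ suc h) ∧ ballot (suc (suc h) ∸ (bit b + a)) w ∎
    where
    open ≡-Reasoning
    a = descentLength m
    guarded : ∀ c → (a ≤ᵇ c) ∧ ballot (suc (c ∸ a)) w ≡ (a ≤ᵇ c) ∧ ballot (suc c ∸ a) w
    guarded c = ∧-congˡ (a ≤ᵇ c) λ a≤ᵇc → cong (λ t → ballot t w) (sym (+-∸-assoc 1 (≤ᵇ⇒≤ a c a≤ᵇc)))
    credit : ∀ b → (a ≤ᵇ suc h ∸ bit b) ∧ ballot (suc (suc h ∸ bit b ∸ a)) w
                   ≡ (bit b + a ≤ᵇ suc h) ∧ ballot (suc (suc h) ∸ (bit b + a)) w
    credit false = guarded (suc h)
    credit true  = trans (guarded h) (cong (_∧ ballot (suc h ∸ a) w) (sym (≤ᵇ-suc a h)))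

  width-stepOf : ∀ b s → width (stepOf b ∷ s) ≡ suc (bit b + width s)
  width-stepOf false s = refl
  width-stepOf true  s = refl

  width-descent : ∀ a s → width (replicate a D ++ s) ≡ a + width s
  width-descent zero    s = refl
  width-descent (suc a) s = cong suc (width-descent a s)

  width-toPath : ∀ w → width (toPath w) ≡ length w + weight cost w
  width-toPath []            = refl
  width-toPath ((b , m) ∷ w) = begin
    width (stepOf b ∷ replicate a D ++ toPath w)
      ≡⟨ width-stepOf b _ ⟩
    suc (bit b + width (replicate a D ++ toPath w))
      ≡⟨ cong (λ t → suc (bit b + t)) (width-descent a (toPath w)) ⟩
    suc (bit b + (a + width (toPath w)))
      ≡⟨ cong (λ t → suc (bit b + (a + t))) (width-toPath w) ⟩
    suc (bit b + (a + (length w + weight cost w)))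
      ≡⟨ cong suc (regroup (bit b) a (length w) (weight cost w)) ⟩
    suc (length w + (bit b + a + weight cost w)) ∎
    where
    open ≡-Reasoning
    a = descentLength m
    regroup : ∀ x a l c → x + (a + (l + c)) ≡ l + (x + a + c)
    regroup = solve-∀

  -- The descent that a U or H step completes, if any.
  closeRun : ℕ → List ℕ
  closeRun zero    = []
  closeRun (suc c) = suc c ∷ []

  descentsFrom-D : ∀ c s → descentsFrom c (D ∷ s) ≡ descentsFrom (suc c) s
  descentsFrom-D zero    s = refl
  descentsFrom-D (suc c) s = refl

  descentsFrom-descent : ∀ a c s → descentsFrom c (replicate a D ++ s) ≡ descentsFrom (a + c) s
  descentsFrom-descent zero    c s = refl
  descentsFrom-descent (suc a) c s = trans (descentsFrom-D c _)
    (trans (descentsFrom-descent a (suc c) s) (cong (λ t → descentsFrom t s) (+-suc a c)))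

  descentsFrom-stepOf : ∀ b c s → descentsFrom c (stepOf b ∷ s) ≡ closeRun c ++ descentsFrom 0 s
  descentsFrom-stepOf false zero    s = refl
  descentsFrom-stepOf false (suc c) s = refl
  descentsFrom-stepOf true  zero    s = refl
  descentsFrom-stepOf true  (suc c) s = refl

  descentLengths : List Block → List ℕ
  descentLengths w = map (suc ∘ ∣_∣) (labelsOf w)

  descentsFrom-toPath : ∀ c w → descentsFrom c (toPath w) ≡ closeRun c ++ descentLengths w
  descentsFrom-toPath zero    []            = refl
  descentsFrom-toPath (suc c) []            = refl
  descentsFrom-toPath c       ((b , m) ∷ w) = begin
    descentsFrom c (stepOf b ∷ replicate a D ++ toPath w)
      ≡⟨ descentsFrom-stepOf b c _ ⟩
    closeRun c ++ descentsFrom 0 (replicate a D ++ toPath w)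
      ≡⟨ cong (closeRun c ++_) (descentsFrom-descent a 0 _) ⟩
    closeRun c ++ descentsFrom (a + 0) (toPath w)
      ≡⟨ cong (λ t → closeRun c ++ descentsFrom t (toPath w)) (+-identityʳ a) ⟩
    closeRun c ++ descentsFrom a (toPath w)
      ≡⟨ cong (closeRun c ++_) (descentsFrom-toPath a w) ⟩
    closeRun c ++ closeRun a ++ descentLengths w
      ≡⟨ cong (closeRun c ++_) (closeRun-descent m) ⟩
    closeRun c ++ descentLengths ((b , m) ∷ w) ∎
    where
    open ≡-Reasoning
    a = descentLength m
    closeRun-descent : ∀ m → closeRun (descentLength m) ++ descentLengths w ≡ descentLengths ((b , m) ∷ w)
    closeRun-descent nothing  = refl
    closeRun-descent (just _) = refl

  descents-toPath : ∀ w → descents (toPath w) ≡ descentLengths w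
  descents-toPath = descentsFrom-toPath 0

  hCount+ddCount-stepOf : ∀ b s →
                          hCount (stepOf b ∷ s) + ddCount (stepOf b ∷ s) ≡ bit b + (hCount s + ddCount s)
  hCount+ddCount-stepOf false s = refl
  hCount+ddCount-stepOf true  s = refl

  hCount-descent : ∀ a s → hCount (replicate a D ++ s) ≡ hCount s
  hCount-descent zero    s = refl
  hCount-descent (suc a) s = hCount-descent a s

  ddCount-descent : ∀ a w → ddCount (replicate a D ++ toPath w) ≡ (a ∸ 1) + ddCount (toPath w)
  ddCount-descent zero          w                 = refl
  ddCount-descent (suc zero)    []                = refl
  ddCount-descent (suc zero)    ((false , _) ∷ _) = refl
  ddCount-descent (suc zero)    ((true , _) ∷ _)  = refl
  ddCount-descent (suc (suc a)) w                 = cong suc (ddCount-descent (suc a) w)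

  ddCount-block : ∀ m w → ddCount (replicate (descentLength m) D ++ toPath w) ≡ labelSize m + ddCount (toPath w)
  ddCount-block nothing  = ddCount-descent 0
  ddCount-block (just S) = ddCount-descent (suc ∣ S ∣)

  hCount+ddCount-toPath : ∀ w → hCount (toPath w) + ddCount (toPath w) ≡ weight hdd w
  hCount+ddCount-toPath []            = refl
  hCount+ddCount-toPath ((b , m) ∷ w) = begin
    hCount (stepOf b ∷ X) + ddCount (stepOf b ∷ X)
      ≡⟨ hCount+ddCount-stepOf b X ⟩
    bit b + (hCount X + ddCount X)
      ≡⟨ cong₂ (λ h d → bit b + (h + d)) (hCount-descent (descentLength m) (toPath w)) (ddCount-block m w) ⟩
    bit b + (hCount (toPath w) + (labelSize m + ddCount (toPath w)))
      ≡⟨ regroup (bit b) (labelSize m) (hCount (toPath w)) (ddCount (toPath w)) ⟩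
    bit b + labelSize m + (hCount (toPath w) + ddCount (toPath w))
      ≡⟨ cong (bit b + labelSize m +_) (hCount+ddCount-toPath w) ⟩
    bit b + labelSize m + weight hdd w ∎
    where
    open ≡-Reasoning
    X = replicate (descentLength m) D ++ toPath w
    regroup : ∀ x s h d → x + (h + (s + d)) ≡ x + s + (h + d)
    regroup = solve-∀

  Parse : List Step → List (Subset e) → Set
  Parse p ls = Σ[ w ∈ List Block ] toPath w ≡ p × labelsOf w ≡ ls

  replicate-D-snoc : ∀ c (s : List Step) → replicate (suc c) D ++ s ≡ replicate c D ++ D ∷ s
  replicate-D-snoc zero    s = refl
  replicate-D-snoc (suc c) s = cong (D ∷_) (replicate-D-snoc c s)

  -- parseBlock b c s reads the rest s of a block that so far consists of stepOf b and c steps D;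
  -- parseNext handles a block that is ended by the step stepOf b′.
  parseBlock : ∀ b c s ls → LabelsFit (descentsFrom c s) ls → Parse (stepOf b ∷ replicate c D ++ s) ls
  parseNext  : ∀ b c b′ s ls → LabelsFit (descentsFrom c (stepOf b′ ∷ s)) ls →
               Parse (stepOf b ∷ replicate c D ++ stepOf b′ ∷ s) ls

  parseBlock b zero    []      []       []       = (b , nothing) ∷ [] , refl , refl
  parseBlock b (suc c) []      (S ∷ []) (r ∷ []) =
    (b , just S) ∷ [] , cong (λ a → stepOf b ∷ replicate (suc a) D ++ []) r , refl
  parseBlock b c       (D ∷ s) ls       fit
    with w , path≡ , labels≡ ← parseBlock b (suc c) s ls (subst (λ l → LabelsFit l ls) (descentsFrom-D c s) fit)
    = w , trans path≡ (cong (stepOf b ∷_) (replicate-D-snoc c s)) , labels≡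
  parseBlock b c       (U ∷ s) ls       fit      = parseNext b c false s ls fit
  parseBlock b c       (H ∷ s) ls       fit      = parseNext b c true s ls fit

  parseNext b c b′ s ls fit = continue c ls (subst (λ l → LabelsFit l ls) (descentsFrom-stepOf b′ c s) fit)
    where
    continue : ∀ c ls → LabelsFit (closeRun c ++ descentsFrom 0 s) ls →
               Parse (stepOf b ∷ replicate c D ++ stepOf b′ ∷ s) ls
    continue zero    ls       fit with w , path≡ , labels≡ ← parseBlock b′ 0 s ls fit =
      (b , nothing) ∷ w , cong (stepOf b ∷_) path≡ , labels≡
    continue (suc c) (S ∷ ls) (r ∷ fit) with w , path≡ , labels≡ ← parseBlock b′ 0 s ls fit =
      (b , just S) ∷ w ,
      cong₂ (λ a t → stepOf b ∷ replicate (suc a) D ++ t) r path≡ ,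
      cong (S ∷_) labels≡

  parse : ∀ p ls → T (staysAbove 0 p) → LabelsFit (descents p) ls → Parse p ls
  parse []      [] _ []  = [] , refl , refl
  parse (U ∷ s) ls _ fit = parseBlock false 0 s ls fit
  parse (H ∷ s) ls _ fit = parseBlock true 0 s ls fit

  stepOf-injective : ∀ {b b′} → stepOf b ≡ stepOf b′ → b ≡ b′
  stepOf-injective {false} {false} _ = refl
  stepOf-injective {true}  {true}  _ = refl

  descent-cancel : ∀ a a′ w w′ → replicate a D ++ toPath w ≡ replicate a′ D ++ toPath w′ →
                   a ≡ a′ × toPath w ≡ toPath w′
  descent-cancel zero    zero     _ _ eq = refl , eq
  descent-cancel (suc a) (suc a′) w w′ eq
    with a≡ , rest≡ ← descent-cancel a a′ w w′ (∷-injectiveʳ eq) = cong suc a≡ , rest≡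
  descent-cancel zero    (suc _)  []                _  ()
  descent-cancel zero    (suc _)  ((false , _) ∷ _) _  ()
  descent-cancel zero    (suc _)  ((true , _) ∷ _)  _  ()
  descent-cancel (suc _) zero     _  []                ()
  descent-cancel (suc _) zero     _  ((false , _) ∷ _) ()
  descent-cancel (suc _) zero     _  ((true , _) ∷ _)  ()

  toPath-labelsOf-injective : ∀ w w′ → toPath w ≡ toPath w′ → labelsOf w ≡ labelsOf w′ → w ≡ w′
  toPath-labelsOf-injective []            []              _     _       = refl
  toPath-labelsOf-injective ((b , m) ∷ w) ((b′ , m′) ∷ w′) path≡ labels≡
    with refl ← stepOf-injective (∷-injectiveˡ path≡)
    with length≡ , rest≡ ← descent-cancel (descentLength m) (descentLength m′) w w′ (∷-injectiveʳ path≡)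
    with m | m′ | length≡ | labels≡
  ... | nothing | nothing | _  | labels≡′ = cong (_ ∷_) (toPath-labelsOf-injective w w′ rest≡ labels≡′)
  ... | just _  | just _  | _  | labels≡′ with refl , labels≡″ ← ∷-injective labels≡′ =
    cong (_ ∷_) (toPath-labelsOf-injective w w′ rest≡ labels≡″)
  ... | nothing | just _  | () | _
  ... | just _  | nothing | () | _

  labelsFit : ∀ w → LabelsFit (descentLengths w) (labelsOf w)
  labelsFit w = fit (labelsOf w)
    where
    fit : ∀ Ss → LabelsFit (map (suc ∘ ∣_∣) Ss) Ss
    fit []       = []
    fit (S ∷ Ss) = refl ∷ fit Ss

  cost≡length : ∀ w → T (ballot 1 w) → weight cost w ≡ length w
  cost≡length w bal = suc-injective (dominating-weight ((false , nothing) ∷ w) bal)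

  width≡2*length : ∀ w → T (ballot 1 w) → width (toPath w) ≡ 2 * length w
  width≡2*length w bal =
    trans (width-toPath w) (cong (length w +_) (trans (cost≡length w bal) (sym (+-identityʳ _))))

  module _ (n k : ℕ) where

    LS : Set
    LS = LabelledSchroeder (suc (suc e)) n k

    PathBlocks : Set
    PathBlocks = Σ[ w ∈ List Block ] length w ≡ n × T (ballot 1 w) × weight hdd w ≡ k

    pathBlocks-≡ : {x y : PathBlocks} → proj₁ x ≡ proj₁ y → x ≡ y
    pathBlocks-≡ = Σ-≡-by-proj₁ (×-irrelevant ≡-irrelevant (×-irrelevant T-irrelevant ≡-irrelevant))

    open LabelledSchroeder

    LS-≡ : {r r′ : LS} → path r ≡ path r′ → labels r ≡ labels r′ → r ≡ r′
    LS-≡ {record { path = p ; schroeder = s ; semilength = sl ; descBound = db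
                 ; labels = ls ; labelsOK = lo ; hddCount = hc }}
         {record { path = .p ; schroeder = s′ ; semilength = sl′ ; descBound = db′
                 ; labels = .ls ; labelsOK = lo′ ; hddCount = hc′ }}
         refl refl
      rewrite T-irrelevant s s′ | ≡-irrelevant sl sl′ | All.irrelevant ≤-irrelevant db db′
            | Pointwise.irrelevant ≡-irrelevant lo lo′ | ≡-irrelevant hc hc′ = refl

    toLS : PathBlocks → LS
    toLS (w , len , bal , hk) = record
      { path       = toPath w
      ; schroeder  = subst T (sym (staysAbove-toPath 0 w)) bal
      ; semilength = trans (width≡2*length w bal) (cong (2 *_) len)
      ; descBound  = subst (All (_≤ suc e)) (sym (descents-toPath w))
                           (map⁺ (universal (λ S → s≤s (∣p∣≤n S)) (labelsOf w)))
      ; labels     = labelsOf w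
      ; labelsOK   = subst (λ l → LabelsFit l (labelsOf w)) (sym (descents-toPath w)) (labelsFit w)
      ; hddCount   = trans (hCount+ddCount-toPath w) hk
      }

    fromParse : (r : LS) → Parse (path r) (labels r) → PathBlocks
    fromParse r (w , path≡ , _) = w , len , bal , hk
      where
      bal : T (ballot 1 w)
      bal = subst T (trans (cong (staysAbove 0) (sym path≡)) (staysAbove-toPath 0 w)) (schroeder r)
      len : length w ≡ n
      len = *-cancelˡ-≡ (length w) n 2
        (trans (sym (width≡2*length w bal)) (trans (cong width path≡) (semilength r)))
      hk : weight hdd w ≡ k
      hk = trans (sym (hCount+ddCount-toPath w)) (trans (cong (λ p → hCount p + ddCount p) path≡) (hddCount r))

    parseLS : (r : LS) → Parse (path r) (labels r)
    parseLS r = parse (path r) (labels r) (schroeder r) (labelsOK r)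

    LS↔PathBlocks : LS ↔ PathBlocks
    LS↔PathBlocks = mk↔ₛ′ (λ r → fromParse r (parseLS r)) toLS
      (λ x → pathBlocks-≡ (parsed-unique (proj₁ x) (parseLS (toLS x))))
      (λ r → let _ , path≡ , labels≡ = parseLS r in LS-≡ path≡ labels≡)
      where
      parsed-unique : ∀ w → (p : Parse (toPath w) (labelsOf w)) → proj₁ p ≡ w
      parsed-unique w (w′ , path≡ , labels≡) = toPath-labelsOf-injective w′ w path≡ labels≡

    -- The block (false , nothing) is a single U step, of cost 0.
    PathBlocks↔DominatingWords : PathBlocks ↔ DominatingWords hdd n k
    PathBlocks↔DominatingWords = mk↔ₛ′
      (λ (w , len , bal , hk) → (false , nothing) ∷ w , cong suc len , bal , hk)
      (λ { ((false , nothing) ∷ w , len , dom , hk) → w , suc-injective len , dom , hk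
         ; ([] , () , _ , _)
         ; ((false , just _) ∷ _ , _ , () , _)
         ; ((true , _) ∷ _ , _ , () , _) })
      (λ { ((false , nothing) ∷ _ , _) → dominating-words-≡ hdd n k refl
         ; ([] , () , _ , _)
         ; ((false , just _) ∷ _ , _ , () , _)
         ; ((true , _) ∷ _ , _ , () , _) })
      (λ _ → pathBlocks-≡ refl)

module Enumeration (e n k : ℕ) where

  open import Defs using (NdNumerator)
  open import Data.Nat using (_+_; _*_; _∸_; _≤_; _≤?_; s≤s)
  open import Data.Nat.Properties using (+-comm; m+n∸n≡m; m∸n+n≡m; m≤n+m; ≰⇒>; <⇒≱)
  open import Data.Nat.Combinatorics using (_C_; nCk≡nC[n∸k]; k>n⇒nCk≡0)
  open import Data.Fin using (Fin)
  open import Data.Product using (Σ-syntax; _,_; proj₁)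
  open import Function.Bundles using (_↔_; mk↔ₛ′)
  open import Function.Properties.Inverse using (↔-trans)
  open import Relation.Nullary using (¬_; yes; no)
  open import Relation.Binary.PropositionalEquality
  open Cardinality
  open Lists
  open Blocks e
  open CycleLemma cost

  N : ℕ
  N = NdNumerator (suc (suc e)) n k

  BalancedWords↔Fin : BalancedWords hdd n k ↔ Fin N
  BalancedWords↔Fin with k ≤? n
  ... | yes k≤n =
    ↔-trans descents-determined (↔-trans (BlockWords↔Fin (suc n) (n ∸ k) k) (Fin-cong binomials))
    where
    descents≡ : ∀ w → weight cost w ≡ n → weight hdd w ≡ k → weight hasDescent w ≡ n ∸ k
    descents≡ w c h = begin
      weight hasDescent w                      ≡⟨ m+n∸n≡m _ k ⟨
      weight hasDescent w + k ∸ k              ≡⟨ cong (λ t → weight hasDescent w + t ∸ k) h ⟨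
      weight hasDescent w + weight hdd w ∸ k   ≡⟨ cong (_∸ k) (trans (sym (weight-cost w)) c) ⟩
      n ∸ k                                    ∎
      where open ≡-Reasoning
    cost≡ : ∀ w → weight hasDescent w ≡ n ∸ k → weight hdd w ≡ k → weight cost w ≡ n
    cost≡ w j h = trans (weight-cost w) (trans (cong₂ _+_ j h) (m∸n+n≡m k≤n))
    descents-determined : BalancedWords hdd n k ↔ BlockWords (suc n) (n ∸ k) k
    descents-determined = mk↔ₛ′
      (λ (w , len , c , h) → w , len , descents≡ w c h , h)
      (λ (w , len , j , h) → w , len , cost≡ w j h , h)
      (λ _ → blockWords-≡ refl)
      (λ _ → balanced-words-≡ hdd n k refl)
    binomials : (suc n C (n ∸ k)) * ((suc n + (n ∸ k) * e) C k) ≡ N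
    binomials = cong₂ _*_ (sym (nCk≡nC[n∸k] (s≤s k≤n))) (cong (_C k) (+-comm 1 (n + (n ∸ k) * e)))
  ... | no k≰n = ↔-trans (¬↔Fin0 too-heavy) (Fin-cong (sym N≡0))
    where
    too-heavy : ¬ BalancedWords hdd n k
    too-heavy (w , _ , c , h) =
      <⇒≱ (≰⇒> k≰n) (subst₂ _≤_ h c (subst (weight hdd w ≤_) (sym (weight-cost w)) (m≤n+m _ _)))
    N≡0 : N ≡ 0
    N≡0 = cong (_* ((n + (n ∸ k) * e + 1) C k)) (k>n⇒nCk≡0 (s≤s (≰⇒> k≰n)))

  dominating-count : Σ[ c ∈ ℕ ] (DominatingWords hdd n k ↔ Fin c)
  dominating-count with c , subtype↔Fin ← finite-subtype BalancedWords↔Fin (λ w → ballot 0 (proj₁ w)) =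
    c , ↔-trans (DominatingWords↔Σ hdd n k) subtype↔Fin

open import Defs
open import Data.Nat using (_*_; _≤_; s≤s)
open import Data.Fin using (Fin)
open import Data.Fin.Permutation using (↔⇒≡)
open import Data.Fin.Properties using (*↔×)
open import Data.Product using (Σ-syntax; _×_; _,_)
open import Data.Product.Function.NonDependent.Propositional using (_×-↔_)
open import Function.Bundles using (_↔_)
open import Function.Properties.Inverse using (↔-refl; ↔-sym)
open import Function.Related.Propositional using (module EquationalReasoning)
open import Relation.Binary.PropositionalEquality using (_≡_)

theorem4p1 : (d n k : ℕ) → 2 ≤ d →
    Σ[ c ∈ ℕ ] ((LabelledSchroeder d n k ↔ Fin c) × (suc n * c ≡ NdNumerator d n k))
theorem4p1 (suc zero)    n k (s≤s ())
theorem4p1 (suc (suc e)) n k _ with c , dominating↔Fin ← Enumeration.dominating-count e n k =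
  c , LS↔Fin , ↔⇒≡ rotations
  where
  open EquationalReasoning
  open Blocks e using (hdd; cost)
  open CycleLemma cost using (DominatingWords; BalancedWords; cycle-lemma)
  open SchröderPaths e using (PathBlocks; LS↔PathBlocks; PathBlocks↔DominatingWords)

  LS↔Fin : LabelledSchroeder (suc (suc e)) n k ↔ Fin c
  LS↔Fin = begin
    LabelledSchroeder (suc (suc e)) n k ↔⟨ LS↔PathBlocks n k ⟩
    PathBlocks n k                      ↔⟨ PathBlocks↔DominatingWords n k ⟩
    DominatingWords hdd n k             ↔⟨ dominating↔Fin ⟩
    Fin c                               ∎

  rotations : Fin (suc n * c) ↔ Fin (NdNumerator (suc (suc e)) n k)
  rotations = begin
    Fin (suc n * c)                          ↔⟨ *↔× ⟩
    (Fin (suc n) × Fin c)                    ↔⟨ ↔-refl ×-↔ ↔-sym dominating↔Fin ⟩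
    (Fin (suc n) × DominatingWords hdd n k)  ↔⟨ cycle-lemma hdd n k ⟩
    BalancedWords hdd n k                    ↔⟨ Enumeration.BalancedWords↔Fin e n k ⟩
    Fin (NdNumerator (suc (suc e)) n k)      ∎
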